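{- Let $(X,\mathcal{O})$ be a sober topological space and $P\subseteq X$, with subspace topology $\mathcal{O}|_P=\{U\cap P\mid U\in\mathcal{O}\}$. The following are equivalent: (i) the space $(P,\mathcal{O}|_P)$ is sober; (ii) for each $x\in X$, we have $x\in P$ if and only if there exists a point $G\in\mathrm{pt}(\mathcal{O}|_P)$ such that for all $U\in\mathcal{O}$, $x\in U \iff U\cap P\in G$.
   Context: For a frame $L$, a point of $L$ is a completely prime filter, i.e. a subset $G\subseteq L$ that is upward-closed, contains the top element, is closed under binary meets, and such that whenever $\bigvee S\in G$ for $S\subseteq L$ then some element of $S$ is in $G$; $\mathrm{pt}(L)$ is the set of points. For $x$ in a space $(Y,\mathcal{O}_Y)$, $F_x=\{U\in\mathcal{O}_Y\mid x\in U\}$ is a point of $\mathcal{O}_Y$. A space is sober if every point of its frame of opens equals $F_x$ for a unique $x$. -}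

module Defs where

open import Level using (Level)
open import Data.Unit using (⊤)
open import Data.Product using (Σ; Σ-syntax; _×_; proj₁)
open import Function.Bundles using (_⇔_)
open import Relation.Binary.PropositionalEquality using (_≡_)

Subset : Set → Set₁
Subset X = X → Set

_⊆_ : {X : Set} → Subset X → Subset X → Set
U ⊆ V = ∀ x → U x → V x

_∩_ : {X : Set} → Subset X → Subset X → Subset X
(U ∩ V) x = U x × V x

whole : {X : Set} → Subset X
whole _ = ⊤

IsUnion : {X : Set} → (Subset X → Set₁) → Subset X → Set₁
IsUnion {X} S W = ∀ (x : X) → W x ⇔ (Σ[ U ∈ Subset X ] (S U × U x))

record Topology (X : Set) : Set₂ where
  field
    Open     : Subset X → Set₁
    Open-ext : ∀ U V → U ⊆ V → V ⊆ U → Open U → Open V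
    Open-whole : Open whole
    Open-∩   : ∀ U V → Open U → Open V → Open (U ∩ V)
    Open-⋃   : ∀ (S : Subset X → Set₁) → (∀ U → S U → Open U) →
               Σ[ W ∈ Subset X ] (Open W × IsUnion S W)

open Topology public

-- A point of the frame of opens (given by the predicate Open):
-- a completely prime filter G of opens.
record IsPoint {Y : Set} (Open : Subset Y → Set₁) (G : Subset Y → Set₁) : Set₂ where
  field
    G-open  : ∀ U → G U → Open U
    G-up    : ∀ U V → Open V → U ⊆ V → G U → G V
    G-top   : G whole
    G-meet  : ∀ U V → G U → G V → G (U ∩ V)
    G-prime : ∀ (S : Subset Y → Set₁) (W : Subset Y) →
              (∀ U → S U → Open U) → Open W → IsUnion S W → G W →
              Σ[ U ∈ Subset Y ] (S U × G U)

-- G equals the neighbourhood filter F_y = { U open | y ∈ U }.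
_≈F_ : {Y : Set} → {Open : Subset Y → Set₁} → (G : Subset Y → Set₁) → Y → Set₁
_≈F_ {Open = Open} G y = ∀ U → Open U → G U ⇔ U y

Sober : {Y : Set} → (Subset Y → Set₁) → Set₂
Sober {Y} Open = ∀ G → IsPoint Open G →
  Σ[ y ∈ Y ] (_≈F_ {Open = Open} G y ×
              (∀ y' → _≈F_ {Open = Open} G y' → y' ≡ y))

-- Subspace topology on P ⊆ X (carrier Σ X P): opens are the U ∩ P, U open.
Restrict : {X : Set} (P : Subset X) → Subset X → Subset (Σ X P)
Restrict P U p = U (proj₁ p)

SubOpen : {X : Set} → Topology X → (P : Subset X) → Subset (Σ X P) → Set₁
SubOpen {X} T P V =
  Σ[ U ∈ Subset X ] (Open T U × (∀ p → V p ⇔ Restrict P U p))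

-- The inclusion ι : P → X pushes each point G of 𝒪|P forward to the point
-- ι*G = { U | U ∩ P ∈ G } of 𝒪. Since X is sober, and in particular T₀,
-- ι*G is the neighbourhood filter of exactly one x ∈ X; condition (ii) says that
-- these x are precisely the elements of P. For (i) ⇒ (ii), an element x of P is
-- hit by its own neighbourhood filter in P, and the point over any x lives at
-- some y ∈ P with F_x = F_y, hence x = y. For (ii) ⇒ (i), a point G of 𝒪|P sits
-- over some x, which then lies in P, and G is the neighbourhood filter of x in P;
-- uniqueness again comes from T₀ together with proof-irrelevance of P.
module Submission where

open import Defs
open import Data.Product using (Σ; Σ-syntax; _×_; _,_; proj₁; proj₂)
open import Data.Unit using (tt)
open import Function using (_∘_; id)
open import Function.Bundles using (_⇔_; mk⇔; Equivalence)
open import Function.Properties.Equivalence using () renaming (sym to ⇔-sym; trans to ⇔-trans)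
open import Relation.Binary.PropositionalEquality using (_≡_; refl; sym; trans; subst)

open Equivalence

isPoint-⇔ : {Y : Set} {Open : Subset Y → Set₁} {G : Subset Y → Set₁} →
            IsPoint Open G → ∀ {V W} → Open V → Open W →
            (∀ y → V y ⇔ W y) → G V ⇔ G W
isPoint-⇔ Gp oV oW V⇔W =
  mk⇔ (G-up _ _ oW (λ y → to (V⇔W y))) (G-up _ _ oV (λ y → from (V⇔W y)))
  where open IsPoint Gp

module _ {Y : Set} (T : Topology Y) where

  nbhd : Y → Subset Y → Set₁
  nbhd y U = Open T U × U y

  nbhd-isPoint : ∀ y → IsPoint (Open T) (nbhd y)
  nbhd-isPoint y = record
    { G-open  = λ _ → proj₁
    ; G-up    = λ U V oV U⊆V (_ , uy) → oV , U⊆V y uy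
    ; G-top   = Open-whole T , tt
    ; G-meet  = λ U V (oU , uy) (oV , vy) → Open-∩ T U V oU oV , uy , vy
    ; G-prime = λ S W oS _ W≡⋃S (_ , wy) →
        let (U , sU , uy) = to (W≡⋃S y) wy in U , sU , oS U sU , uy
    }

  nbhd-≈F : ∀ y → _≈F_ {Open = Open T} (nbhd y) y
  nbhd-≈F y U oU = mk⇔ proj₂ (oU ,_)

  sober⇒T₀ : Sober (Open T) → ∀ {x y} → (∀ U → Open T U → U x ⇔ U y) → x ≡ y
  sober⇒T₀ sob {x} {y} x~y =
    let (_ , _ , unique) = sob (nbhd x) (nbhd-isPoint x)
    in trans (unique x (nbhd-≈F x)) (sym (unique y nbhd-x≈F-y))
    where
    nbhd-x≈F-y : _≈F_ {Open = Open T} (nbhd x) y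
    nbhd-x≈F-y U oU = mk⇔ (to (x~y U oU) ∘ proj₂) (λ uy → oU , from (x~y U oU) uy)

module _ {X : Set} (T : Topology X) (P : Subset X) where

  restrict-open : ∀ {U} → Open T U → SubOpen T P (Restrict P U)
  restrict-open {U} oU = U , oU , λ _ → mk⇔ id id

  subspace : Topology (Σ X P)
  subspace = record
    { Open       = SubOpen T P
    ; Open-ext   = λ V W V⊆W W⊆V (U , oU , V≡U) →
        U , oU , λ p → mk⇔ (to (V≡U p) ∘ W⊆V p) (V⊆W p ∘ from (V≡U p))
    ; Open-whole = restrict-open (Open-whole T)
    ; Open-∩     = λ { V W (U , oU , V≡U) (U' , oU' , W≡U') →
        U ∩ U' , Open-∩ T U U' oU oU' ,
        λ p → mk⇔ (λ (v , w) → to (V≡U p) v , to (W≡U' p) w)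
                  (λ (u , u') → from (V≡U p) u , from (W≡U' p) u') }
    ; Open-⋃     = ⋃
    }
    where
    ⋃ : ∀ (S : Subset (Σ X P) → Set₁) → (∀ V → S V → SubOpen T P V) →
        Σ[ W ∈ Subset (Σ X P) ] (SubOpen T P W × IsUnion S W)
    ⋃ S oS =
      let (W , oW , W≡⋃S̃) = Open-⋃ T S̃ (λ _ → proj₁)
      in Restrict P W , (W , oW , λ _ → mk⇔ id id) ,
         λ p → mk⇔
           (λ w → let (U , (_ , V , sV , V≡U) , u) = to (W≡⋃S̃ (proj₁ p)) w
                  in V , sV , from (V≡U p) u)
           (λ (V , sV , v) → let (U , oU , V≡U) = oS V sV
                             in from (W≡⋃S̃ (proj₁ p)) (U , (oU , V , sV , V≡U) , to (V≡U p) v))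
      where
      S̃ : Subset X → Set₁
      S̃ U = Open T U × Σ[ V ∈ Subset (Σ X P) ] (S V × (∀ p → V p ⇔ Restrict P U p))

module _ {X Y : Set} (T : Topology X) (f : Y → X) where

  pushforward : (Subset Y → Set₁) → Subset X → Set₁
  pushforward G U = Open T U × G (U ∘ f)

  PushesForwardTo : (Subset Y → Set₁) → X → Set₁
  PushesForwardTo G x = ∀ U → Open T U → U x ⇔ G (U ∘ f)

  ≈F⇒PushesForwardTo : ∀ {G x} → _≈F_ {Open = Open T} (pushforward G) x →
                       PushesForwardTo G x
  ≈F⇒PushesForwardTo ι*G≈x U oU =
    mk⇔ (proj₂ ∘ from (ι*G≈x U oU)) (λ g → to (ι*G≈x U oU) (oU , g))

  pushesForwardTo-unique : Sober (Open T) → ∀ {G x x'} →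
    PushesForwardTo G x → PushesForwardTo G x' → x ≡ x'
  pushesForwardTo-unique sob over over' =
    sober⇒T₀ T sob (λ U oU → ⇔-trans (over U oU) (⇔-sym (over' U oU)))

  module _ {OpenY : Subset Y → Set₁} (f-cont : ∀ {U} → Open T U → OpenY (U ∘ f)) where

    ≈F⇒PushesForwardTo-image : ∀ {G y} → _≈F_ {Open = OpenY} G y →
                               PushesForwardTo G (f y)
    ≈F⇒PushesForwardTo-image G≈y U oU = ⇔-sym (G≈y (U ∘ f) (f-cont oU))

    pushforward-isPoint : ∀ {G} → IsPoint OpenY G → IsPoint (Open T) (pushforward G)
    pushforward-isPoint {G} Gp = record
      { G-open  = λ _ → proj₁
      ; G-up    = λ U V oV U⊆V (_ , g) → oV , G-up (U ∘ f) (V ∘ f) (f-cont oV) (U⊆V ∘ f) g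
      ; G-top   = Open-whole T , G-top
      ; G-meet  = λ U V (oU , gU) (oV , gV) → Open-∩ T U V oU oV , G-meet (U ∘ f) (V ∘ f) gU gV
      ; G-prime = prime
      }
      where
      open IsPoint Gp
      prime : ∀ (S : Subset X → Set₁) W → (∀ U → S U → Open T U) → Open T W →
              IsUnion S W → pushforward G W → Σ[ U ∈ Subset X ] (S U × pushforward G U)
      prime S W oS oW W≡⋃S (_ , gW)
        with G-prime f⁻¹S (W ∘ f) of⁻¹S (f-cont oW) W∘f≡⋃f⁻¹S gW
        where
        f⁻¹S : Subset Y → Set₁
        f⁻¹S V = Σ[ U ∈ Subset X ] (S U × V ≡ U ∘ f)
        of⁻¹S : ∀ V → f⁻¹S V → OpenY V
        of⁻¹S _ (U , sU , refl) = f-cont (oS U sU)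
        W∘f≡⋃f⁻¹S : IsUnion f⁻¹S (W ∘ f)
        W∘f≡⋃f⁻¹S y = mk⇔
          (λ w → let (U , sU , u) = to (W≡⋃S (f y)) w in U ∘ f , (U , sU , refl) , u)
          (λ { (_ , (U , sU , refl) , u) → from (W≡⋃S (f y)) (U , sU , u) })
      ... | _ , (U , sU , refl) , gU = U , sU , oS U sU , gU

module _ (X : Set) (T : Topology X) (sob : Sober (Open T))
         (P : Subset X) (P-irrelevant : ∀ x (a b : P x) → a ≡ b) where

  private
    𝒪P = SubOpen T P
    ι : Σ X P → X
    ι = proj₁

  PointsOver : X → Set₂
  PointsOver x = Σ[ G ∈ (Subset (Σ X P) → Set₁) ] (IsPoint 𝒪P G × PushesForwardTo T ι G x)

  pushesForwardTo⇒≈F : ∀ {G x} → IsPoint 𝒪P G → PushesForwardTo T ι G x →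
                       (a : P x) → _≈F_ {Open = 𝒪P} G (x , a)
  pushesForwardTo⇒≈F Gp over a V oV@(U , oU , V≡U) =
    ⇔-trans (⇔-trans (isPoint-⇔ Gp oV (restrict-open T P oU) V≡U) (⇔-sym (over U oU)))
            (⇔-sym (V≡U (_ , a)))

  sober⇒points-over : Sober 𝒪P → ∀ x → P x ⇔ PointsOver x
  sober⇒points-over sobP x = mk⇔ nbhd-over in-P
    where
    nbhd-over : P x → PointsOver x
    nbhd-over a = nbhd (subspace T P) (x , a) , nbhd-isPoint (subspace T P) (x , a) ,
                  ≈F⇒PushesForwardTo-image T ι (restrict-open T P) (nbhd-≈F (subspace T P) (x , a))
    in-P : PointsOver x → P x
    in-P (G , Gp , over) =
      let ((y , p) , G≈y , _) = sobP G Gp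
      in subst P (pushesForwardTo-unique T ι sob {G = G}
                   (≈F⇒PushesForwardTo-image T ι (restrict-open T P) {G = G} G≈y) over) p

  points-over⇒sober : (∀ x → P x ⇔ PointsOver x) → Sober 𝒪P
  points-over⇒sober P⇔over G Gp
    with sob (pushforward T ι G) (pushforward-isPoint T ι (restrict-open T P) Gp)
  ... | x , ι*G≈x , _ = (x , a) , pushesForwardTo⇒≈F Gp over a , unique
    where
    over : PushesForwardTo T ι G x
    over = ≈F⇒PushesForwardTo T ι {G = G} ι*G≈x
    a : P x
    a = from (P⇔over x) (G , Gp , over)
    unique : ∀ y → _≈F_ {Open = 𝒪P} G y → y ≡ (x , a)
    unique (x' , a') G≈y
      with pushesForwardTo-unique T ι sob {G = G}
             (≈F⇒PushesForwardTo-image T ι (restrict-open T P) {G = G} G≈y) over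
    ... | refl with P-irrelevant x a' a
    ... | refl = refl

mainTheorem3 : (X : Set) (T : Topology X) → Sober (Open T) →
    (P : Subset X) → (∀ x (a b : P x) → a ≡ b) →
    Sober (SubOpen T P) ⇔
      (∀ (x : X) → P x ⇔
        (Σ[ G ∈ (Subset (Σ X P) → Set₁) ]
          (IsPoint (SubOpen T P) G ×
           (∀ U → Open T U → U x ⇔ G (Restrict P U)))))
mainTheorem3 X T sob P P-irrelevant =
  mk⇔ (sober⇒points-over X T sob P P-irrelevant) (points-over⇒sober X T sob P P-irrelevant)
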